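{- Let $V$ be a ground set of $n$ elements with $n$ even, let $\varepsilon>0$ satisfy $\varepsilon^2=\frac1n\cdot\omega(\ln n)$, let $\beta=\frac n4(1+\varepsilon)$ be an integer, and let $R\subseteq V$ with $|R|=\frac n2$. Define, for $S\subseteq V$ (with $\bar S=V\setminus S$, $\bar R=V\setminus R$), $f_1(S)=\min\left(|S|,\frac n2\right)-\frac{|S|}{2}$ and $f_2(S)=\min\left(|S|,\frac n2,\beta+|S\cap R|,\beta+|S\cap\bar R|\right)-\frac{|S|}{2}$. Then $f_1$ and $f_2$ are nonnegative, submodular, and symmetric.
   Context: A function $f$ on $2^V$ is submodular if $f(S)+f(T)\ge f(S\cup T)+f(S\cap T)$ for all $S,T\subseteq V$, and symmetric if $f(S)=f(V\setminus S)$ for all $S$. -}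

module Defs where

open import Data.Nat using (ℕ)
open import Data.Integer using (+_)
open import Data.Rational using (ℚ; _/_; _+_; _-_; _*_; _⊓_; _≤_; 0ℚ; ½)
open import Data.Fin.Subset using (Subset; ∣_∣; _∩_; _∪_; ∁)
open import Relation.Binary.PropositionalEquality using (_≡_)

⟦_⟧ : ℕ → ℚ
⟦ k ⟧ = + k / 1

card : {n : ℕ} → Subset n → ℚ
card S = ⟦ ∣ S ∣ ⟧

-- set functions on 2^V, V = Fin n, valued in ℚ
SetFn : ℕ → Set
SetFn n = Subset n → ℚ

Submodular : {n : ℕ} → SetFn n → Set
Submodular f = ∀ S T → f (S ∪ T) + f (S ∩ T) ≤ f S + f T

Symmetric : {n : ℕ} → SetFn n → Set
Symmetric f = ∀ S → f S ≡ f (∁ S)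

Nonnegative : {n : ℕ} → SetFn n → Set
Nonnegative f = ∀ S → 0ℚ ≤ f S

f₁ : (n : ℕ) → SetFn n
f₁ n S = (card S ⊓ (⟦ n ⟧ * ½)) - card S * ½

f₂ : (n : ℕ) → ℕ → Subset n → SetFn n
f₂ n β R S =
  (((card S ⊓ (⟦ n ⟧ * ½)) ⊓ (⟦ β ⟧ + card (S ∩ R))) ⊓ (⟦ β ⟧ + card (S ∩ ∁ R)))
    - card S * ½

module Submission where

-- Write n = 2h and, for a set S, a = |S ∩ R|, b = |S ∩ R̄|, so |S| = a + b.  Then
--   f₂(S) = M(a,b) - (a+b)/2,   M(a,b) = min(a+b, h, β+a, β+b),
-- and f₁ is the instance β = h of f₂ (the β-terms never attain the minimum).
-- The four pieces of M are affine, with 0/1 coefficients u, v on a, b and constant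
-- offset c(u,v); the offsets are submodular on the lattice {0,1}² exactly when
-- h ≤ 2β.  On the values at S ∪ T, S ∩ T, S, T (a "crossing quadruple"), the
-- piece of the meet at S ∪ T plus the piece of the join at S ∩ T is bounded by the
-- pieces attaining the minimum at S and at T; this gives submodularity of M, hence
-- of f₂.  Complementation (a,b) ↦ (h-a, h-b) permutes the pieces up to the shift
-- h - (a+b), which gives symmetry, and nonnegativity follows from submodularity
-- and symmetry, since 2f(S) = f(S) + f(S̄) ≥ f(V) + f(∅) = 0.
-- The file develops: crossing quadruples; minima of four pieces; the function M
-- on ℕ; cardinalities of subsets; the embedding ℕ → ℚ; general set-function
-- facts; the properties of f₂; and finally lemma3, where h ≤ 2β comes from ε > 0.

open import Data.Nat using (ℕ)
open import Relation.Binary.PropositionalEquality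

-- Crossing quadruples: the values u, i, s, t of a modular, monotone quantity
-- (such as |· ∩ R|) at S ∪ T, S ∩ T, S and T.
module Crossings where

  open import Data.Nat using (_≤_; _+_)
  open import Data.Nat.Properties using (+-mono-≤; +-commutativeSemigroup)
  open import Algebra.Properties.CommutativeSemigroup +-commutativeSemigroup using (interchange)

  record Crossing (u i s t : ℕ) : Set where
    field
      i≤s : i ≤ s
      i≤t : i ≤ t
      modular : u + i ≡ s + t

  crossing-+ : ∀ {u i s t u′ i′ s′ t′} → Crossing u i s t → Crossing u′ i′ s′ t′ →
    Crossing (u + u′) (i + i′) (s + s′) (t + t′)
  crossing-+ {u} {i} {s} {t} {u′} {i′} {s′} {t′} c c′ = record
    { i≤s = +-mono-≤ (Crossing.i≤s c) (Crossing.i≤s c′)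
    ; i≤t = +-mono-≤ (Crossing.i≤t c) (Crossing.i≤t c′)
    ; modular = trans (interchange u u′ i i′)
                  (trans (cong₂ _+_ (Crossing.modular c) (Crossing.modular c′)) (interchange s t s′ t′))
    }

module MinOfPieces where

  open import Data.Bool using (Bool; true; false; not)
  open import Data.Nat using (_≤_; _+_; _⊓_)
  open import Data.Nat.Properties
    using (⊓-sel; m⊓n≤m; m⊓n≤n; ≤-trans; +-distribʳ-⊓; ⊓-comm; ⊓-commutativeSemigroup)
  open import Data.Product using (∃₂; _,_)
  open import Data.Sum using (inj₁; inj₂)
  open import Algebra.Properties.CommutativeSemigroup ⊓-commutativeSemigroup using (xy∙z≈xz∙y)

  minPieces : (Bool → Bool → ℕ) → ℕ
  minPieces p = ((p true true ⊓ p false false) ⊓ p true false) ⊓ p false true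

  minPieces-≤ : ∀ p u v → minPieces p ≤ p u v
  minPieces-≤ p true  true  = ≤-trans (m⊓n≤m _ _) (≤-trans (m⊓n≤m _ _) (m⊓n≤m _ _))
  minPieces-≤ p false false = ≤-trans (m⊓n≤m _ _) (≤-trans (m⊓n≤m _ _) (m⊓n≤n _ _))
  minPieces-≤ p true  false = ≤-trans (m⊓n≤m _ _) (m⊓n≤n _ _)
  minPieces-≤ p false true  = m⊓n≤n _ _

  minPieces-attained : ∀ p → ∃₂ λ u v → minPieces p ≡ p u v
  minPieces-attained p with ⊓-sel ((p true true ⊓ p false false) ⊓ p true false) (p false true)
  ... | inj₂ e = false , true , e
  ... | inj₁ e with ⊓-sel (p true true ⊓ p false false) (p true false)
  ...   | inj₂ e′ = true , false , trans e e′
  ...   | inj₁ e′ with ⊓-sel (p true true) (p false false)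
  ...     | inj₁ e″ = true , true , trans e (trans e′ e″)
  ...     | inj₂ e″ = false , false , trans e (trans e′ e″)

  minPieces-+ : ∀ p k → minPieces p + k ≡ minPieces (λ u v → p u v + k)
  minPieces-+ p k = begin
    minPieces p + k
      ≡⟨ +-distribʳ-⊓ k _ _ ⟩
    (((p true true ⊓ p false false) ⊓ p true false) + k) ⊓ (p false true + k)
      ≡⟨ cong (_⊓ (p false true + k)) (+-distribʳ-⊓ k _ _) ⟩
    (((p true true ⊓ p false false) + k) ⊓ (p true false + k)) ⊓ (p false true + k)
      ≡⟨ cong (λ z → (z ⊓ (p true false + k)) ⊓ (p false true + k)) (+-distribʳ-⊓ k _ _) ⟩
    minPieces (λ u v → p u v + k) ∎
    where open ≡-Reasoning

  minPieces-flip : ∀ p → minPieces (λ u v → p (not u) (not v)) ≡ minPieces p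
  minPieces-flip p = begin
    ((p false false ⊓ p true true) ⊓ p false true) ⊓ p true false
      ≡⟨ cong (λ z → (z ⊓ p false true) ⊓ p true false) (⊓-comm (p false false) (p true true)) ⟩
    ((p true true ⊓ p false false) ⊓ p false true) ⊓ p true false
      ≡⟨ xy∙z≈xz∙y (p true true ⊓ p false false) (p false true) (p true false) ⟩
    minPieces p ∎
    where open ≡-Reasoning

  minPieces-cong : ∀ {p q} → (∀ u v → p u v ≡ q u v) → minPieces p ≡ minPieces q
  minPieces-cong eq = cong₂ _⊓_ (cong₂ _⊓_ (cong₂ _⊓_ (eq true true) (eq false false)) (eq true false)) (eq false true)

module CutFunction (h β : ℕ) where

  open import Data.Bool using (Bool; true; false; not; _∧_; _∨_)
  open import Data.Nat using (_≤_; _+_; z≤n)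
  open import Data.Nat.Properties
    using (≤-refl; ≤-reflexive; ≤-trans; +-mono-≤; +-comm; +-identityʳ; m≤m+n; +-commutativeSemigroup; module ≤-Reasoning)
  open import Data.Product using (_,_)
  open import Algebra.Properties.CommutativeSemigroup +-commutativeSemigroup using (interchange)
  open MinOfPieces
  open Crossings
  open import Data.Nat.Solver using (module +-*-Solver)
  open +-*-Solver using (solve; _:+_; _:=_)

  -- piece u v depends on a iff u and on b iff v.
  piece : Bool → Bool → ℕ → ℕ → ℕ
  piece true  true  a b = a + b
  piece false false a b = h
  piece true  false a b = β + a
  piece false true  a b = β + b

  M : ℕ → ℕ → ℕ
  M a b = minPieces (λ u v → piece u v a b)

  offset : Bool → Bool → ℕ
  offset true  true  = 0
  offset false false = h
  offset true  false = β
  offset false true  = β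

  pick : Bool → ℕ → ℕ
  pick true  a = a
  pick false a = 0

  piece-decomposition : ∀ u v a b → piece u v a b ≡ offset u v + (pick u a + pick v b)
  piece-decomposition true  true  a b = refl
  piece-decomposition false false a b = sym (+-identityʳ h)
  piece-decomposition true  false a b = cong (β +_) (sym (+-identityʳ a))
  piece-decomposition false true  a b = refl

  -- The offsets are submodular on {0,1}²; the only incomparable pairs
  -- {(1,0), (0,1)} need h + 0 ≤ β + β.
  offset-submodular : h ≤ β + β → ∀ u v u′ v′ →
    offset (u ∧ u′) (v ∧ v′) + offset (u ∨ u′) (v ∨ v′) ≤ offset u v + offset u′ v′
  offset-submodular h≤2β true  true  u′    v′    = ≤-reflexive (+-comm (offset u′ v′) 0)
  offset-submodular h≤2β false false u′    v′    = ≤-refl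
  offset-submodular h≤2β true  false true  true  = ≤-refl
  offset-submodular h≤2β true  false true  false = ≤-refl
  offset-submodular h≤2β true  false false true  = ≤-trans (≤-reflexive (+-identityʳ h)) h≤2β
  offset-submodular h≤2β true  false false false = ≤-reflexive (+-comm h β)
  offset-submodular h≤2β false true  true  true  = ≤-refl
  offset-submodular h≤2β false true  true  false = ≤-trans (≤-reflexive (+-identityʳ h)) h≤2β
  offset-submodular h≤2β false true  false true  = ≤-refl
  offset-submodular h≤2β false true  false false = ≤-reflexive (+-comm h β)

  pick-crossing : ∀ {u i s t} → Crossing u i s t → ∀ x y →
    pick (x ∧ y) u + pick (x ∨ y) i ≤ pick x s + pick y t
  pick-crossing c true  true  = ≤-reflexive (Crossing.modular c)
  pick-crossing c true  false = ≤-trans (Crossing.i≤s c) (m≤m+n _ 0)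
  pick-crossing c false true  = Crossing.i≤t c
  pick-crossing c false false = z≤n

  piece-crossing : h ≤ β + β →
    ∀ {aU aI aS aT bU bI bS bT} → Crossing aU aI aS aT → Crossing bU bI bS bT → ∀ u v u′ v′ →
    piece (u ∧ u′) (v ∧ v′) aU bU + piece (u ∨ u′) (v ∨ v′) aI bI ≤ piece u v aS bS + piece u′ v′ aT bT
  piece-crossing h≤2β {aU} {aI} {aS} {aT} {bU} {bI} {bS} {bT} ca cb u v u′ v′ = begin
    piece (u ∧ u′) (v ∧ v′) aU bU + piece (u ∨ u′) (v ∨ v′) aI bI
      ≡⟨ cong₂ _+_ (piece-decomposition (u ∧ u′) (v ∧ v′) aU bU) (piece-decomposition (u ∨ u′) (v ∨ v′) aI bI) ⟩
    (offset (u ∧ u′) (v ∧ v′) + (pick (u ∧ u′) aU + pick (v ∧ v′) bU))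
      + (offset (u ∨ u′) (v ∨ v′) + (pick (u ∨ u′) aI + pick (v ∨ v′) bI))
      ≡⟨ regroup (offset (u ∧ u′) (v ∧ v′)) (pick (u ∧ u′) aU) (pick (v ∧ v′) bU)
                 (offset (u ∨ u′) (v ∨ v′)) (pick (u ∨ u′) aI) (pick (v ∨ v′) bI) ⟩
    (offset (u ∧ u′) (v ∧ v′) + offset (u ∨ u′) (v ∨ v′))
      + ((pick (u ∧ u′) aU + pick (u ∨ u′) aI) + (pick (v ∧ v′) bU + pick (v ∨ v′) bI))
      ≤⟨ +-mono-≤ (offset-submodular h≤2β u v u′ v′)
                  (+-mono-≤ (pick-crossing ca u u′) (pick-crossing cb v v′)) ⟩
    (offset u v + offset u′ v′) + ((pick u aS + pick u′ aT) + (pick v bS + pick v′ bT))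
      ≡⟨ regroup (offset u v) (pick u aS) (pick v bS) (offset u′ v′) (pick u′ aT) (pick v′ bT) ⟨
    (offset u v + (pick u aS + pick v bS)) + (offset u′ v′ + (pick u′ aT + pick v′ bT))
      ≡⟨ cong₂ _+_ (piece-decomposition u v aS bS) (piece-decomposition u′ v′ aT bT) ⟨
    piece u v aS bS + piece u′ v′ aT bT ∎
    where
    open ≤-Reasoning
    regroup : ∀ o x y o′ x′ y′ → (o + (x + y)) + (o′ + (x′ + y′)) ≡ (o + o′) + ((x + x′) + (y + y′))
    regroup o x y o′ x′ y′ = trans (interchange o (x + y) o′ (x′ + y′)) (cong (o + o′ +_) (interchange x y x′ y′))

  -- Submodularity of M along crossing quadruples: bound the left side by the
  -- meet/join pieces of the pieces attaining the minima at S and T.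
  M-submodular : h ≤ β + β →
    ∀ {aU aI aS aT bU bI bS bT} → Crossing aU aI aS aT → Crossing bU bI bS bT →
    M aU bU + M aI bI ≤ M aS bS + M aT bT
  M-submodular h≤2β {aU} {aI} {aS} {aT} {bU} {bI} {bS} {bT} ca cb
    with minPieces-attained (λ u v → piece u v aS bS) | minPieces-attained (λ u v → piece u v aT bT)
  ... | u , v , eqS | u′ , v′ , eqT = begin
    M aU bU + M aI bI
      ≤⟨ +-mono-≤ (minPieces-≤ (λ u v → piece u v aU bU) (u ∧ u′) (v ∧ v′))
                  (minPieces-≤ (λ u v → piece u v aI bI) (u ∨ u′) (v ∨ v′)) ⟩
    piece (u ∧ u′) (v ∧ v′) aU bU + piece (u ∨ u′) (v ∨ v′) aI bI
      ≤⟨ piece-crossing h≤2β ca cb u v u′ v′ ⟩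
    piece u v aS bS + piece u′ v′ aT bT
      ≡⟨ cong₂ _+_ eqS eqT ⟨
    M aS bS + M aT bT ∎
    where open ≤-Reasoning

  piece-complement : ∀ {a a′ b b′} → a + a′ ≡ h → b + b′ ≡ h → ∀ u v →
    piece (not u) (not v) a′ b′ + (a + b) ≡ piece u v a b + h
  piece-complement {a} {a′} {b} {b′} ea eb true  true  = +-comm h (a + b)
  piece-complement {a} {a′} {b} {b′} ea eb false false = begin
    (a′ + b′) + (a + b) ≡⟨ solve 4 (λ a a′ b b′ → (a′ :+ b′) :+ (a :+ b) := (a :+ a′) :+ (b :+ b′)) refl a a′ b b′ ⟩
    (a + a′) + (b + b′) ≡⟨ cong₂ _+_ ea eb ⟩
    h + h ∎
    where open ≡-Reasoning
  piece-complement {a} {a′} {b} {b′} ea eb true  false = begin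
    (β + b′) + (a + b)  ≡⟨ solve 4 (λ β a b b′ → (β :+ b′) :+ (a :+ b) := (β :+ a) :+ (b :+ b′)) refl β a b b′ ⟩
    (β + a) + (b + b′)  ≡⟨ cong ((β + a) +_) eb ⟩
    (β + a) + h ∎
    where open ≡-Reasoning
  piece-complement {a} {a′} {b} {b′} ea eb false true  = begin
    (β + a′) + (a + b)  ≡⟨ solve 4 (λ β a a′ b → (β :+ a′) :+ (a :+ b) := (β :+ b) :+ (a :+ a′)) refl β a a′ b ⟩
    (β + b) + (a + a′)  ≡⟨ cong ((β + b) +_) ea ⟩
    (β + b) + h ∎
    where open ≡-Reasoning

  M-complement : ∀ {a a′ b b′} → a + a′ ≡ h → b + b′ ≡ h → M a′ b′ + (a + b) ≡ M a b + h
  M-complement {a} {a′} {b} {b′} ea eb = begin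
    M a′ b′ + (a + b)
      ≡⟨ minPieces-+ (λ u v → piece u v a′ b′) (a + b) ⟩
    minPieces (λ u v → piece u v a′ b′ + (a + b))
      ≡⟨ minPieces-flip (λ u v → piece u v a′ b′ + (a + b)) ⟨
    minPieces (λ u v → piece (not u) (not v) a′ b′ + (a + b))
      ≡⟨ minPieces-cong (piece-complement ea eb) ⟩
    minPieces (λ u v → piece u v a b + h)
      ≡⟨ minPieces-+ (λ u v → piece u v a b) h ⟨
    M a b + h ∎
    where open ≡-Reasoning

module SubsetCardinality where

  open import Data.Bool using (true; false)
  open import Data.Nat using (_+_; _∸_; _≤_; suc)
  open import Data.Nat.Properties using (+-suc; m+n∸n≡m)
  open import Data.Vec using ([]; _∷_)
  open import Data.Fin.Subset using (Subset; ∣_∣; _∩_; _∪_; ∁; ⊥)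
  open import Data.Fin.Subset.Properties
    using (∩-comm; ∩-assoc; ∩-idem; ∩-zeroˡ; ∩-distribʳ-∪; ∣p∩q∣≤∣p∣; ∣p∩q∣≤∣q∣; ∣⊥∣≡0; ∣∁p∣≡n∸∣p∣)

  open Crossings

  card-modular : ∀ {n} (X Y : Subset n) → ∣ X ∪ Y ∣ + ∣ X ∩ Y ∣ ≡ ∣ X ∣ + ∣ Y ∣
  card-modular []          []          = refl
  card-modular (true  ∷ X) (true  ∷ Y) = cong suc (trans (+-suc _ _) (trans (cong suc (card-modular X Y)) (sym (+-suc _ _))))
  card-modular (true  ∷ X) (false ∷ Y) = cong suc (card-modular X Y)
  card-modular (false ∷ X) (true  ∷ Y) = trans (cong suc (card-modular X Y)) (sym (+-suc _ _))
  card-modular (false ∷ X) (false ∷ Y) = card-modular X Y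

  card-split : ∀ {n} (X Y : Subset n) → ∣ X ∩ Y ∣ + ∣ X ∩ ∁ Y ∣ ≡ ∣ X ∣
  card-split []          []          = refl
  card-split (true  ∷ X) (true  ∷ Y) = cong suc (card-split X Y)
  card-split (true  ∷ X) (false ∷ Y) = trans (+-suc _ _) (cong suc (card-split X Y))
  card-split (false ∷ X) (true  ∷ Y) = card-split X Y
  card-split (false ∷ X) (false ∷ Y) = card-split X Y

  card-crossing : ∀ {n} (X Y : Subset n) → Crossing (∣ X ∪ Y ∣) (∣ X ∩ Y ∣) (∣ X ∣) (∣ Y ∣)
  card-crossing X Y = record { i≤s = ∣p∩q∣≤∣p∣ X Y ; i≤t = ∣p∩q∣≤∣q∣ X Y ; modular = card-modular X Y }

  ∩-distribʳ-∩ : ∀ {n} (S T R : Subset n) → (S ∩ T) ∩ R ≡ (S ∩ R) ∩ (T ∩ R)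
  ∩-distribʳ-∩ S T R = begin
    (S ∩ T) ∩ R        ≡⟨ cong ((S ∩ T) ∩_) (∩-idem R) ⟨
    (S ∩ T) ∩ (R ∩ R)  ≡⟨ ∩-assoc S T (R ∩ R) ⟩
    S ∩ (T ∩ (R ∩ R))  ≡⟨ cong (S ∩_) (∩-assoc T R R) ⟨
    S ∩ ((T ∩ R) ∩ R)  ≡⟨ cong (S ∩_) (∩-comm (T ∩ R) R) ⟩
    S ∩ (R ∩ (T ∩ R))  ≡⟨ ∩-assoc S R (T ∩ R) ⟨
    (S ∩ R) ∩ (T ∩ R)  ∎
    where open ≡-Reasoning

  restriction-crossing : ∀ {n} (S T R : Subset n) →
    Crossing (∣ (S ∪ T) ∩ R ∣) (∣ (S ∩ T) ∩ R ∣) (∣ S ∩ R ∣) (∣ T ∩ R ∣)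
  restriction-crossing S T R
    rewrite ∩-distribʳ-∪ R S T | ∩-distribʳ-∩ S T R = card-crossing (S ∩ R) (T ∩ R)

  complement-split : ∀ {n} (S Y : Subset n) → ∣ S ∩ Y ∣ + ∣ ∁ S ∩ Y ∣ ≡ ∣ Y ∣
  complement-split S Y =
    trans (cong₂ (λ A B → ∣ A ∣ + ∣ B ∣) (∩-comm S Y) (∩-comm (∁ S) Y)) (card-split Y S)

  card-∁-half : ∀ {h} (R : Subset (h + h)) → ∣ R ∣ ≡ h → ∣ ∁ R ∣ ≡ h
  card-∁-half {h} R |R|≡h = trans (∣∁p∣≡n∸∣p∣ R) (trans (cong ((h + h) ∸_) |R|≡h) (m+n∸n≡m h h))

  card-⊥∩ : ∀ {n} (Y : Subset n) → ∣ ⊥ ∩ Y ∣ ≡ 0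
  card-⊥∩ {n} Y = trans (cong ∣_∣ (∩-zeroˡ Y)) (∣⊥∣≡0 n)

open import Defs
open import Data.Nat as ℕ using (z≤n)
import Data.Nat.Properties as ℕP
open import Algebra.Properties.CommutativeSemigroup ℕP.+-commutativeSemigroup
  using () renaming (interchange to ℕ-interchange)
import Data.Nat.Coprimality as Coprime
open import Data.Nat.Divisibility using (_∣_; divides)
open import Data.Integer as ℤ using (+_)
import Data.Integer.Properties as ℤP
open import Data.Rational using (ℚ; mkℚ; _/_; _+_; _-_; -_; _*_; _⊓_; _≤_; _<_; 0ℚ; 1ℚ; ½; *≤*; nonNegative)
open import Data.Rational.Properties
open import Data.Rational.Solver using (module +-*-Solver)
open import Data.Fin.Subset using (Subset; ∣_∣; _∩_; _∪_; ∁; ⊥; ⊤)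
open import Data.Fin.Subset.Properties using (p∪∁p≡⊤; ∩-inverseʳ; ∪-identityˡ)
open import Data.Product using (_×_; _,_)
open import Data.Sum using (inj₁; inj₂)

open +-*-Solver using (solve; _:+_; _:-_; _:*_; _:=_; con)

coprime : ∀ k → Coprime.Coprime k 1
coprime k = Coprime.sym (Coprime.1-coprimeTo k)

⟦⟧-canonical : ∀ k → ⟦ k ⟧ ≡ mkℚ (+ k) 0 (coprime k)
⟦⟧-canonical k = normalize-coprime (coprime k)

⟦⟧-+ : ∀ m k → ⟦ m ℕ.+ k ⟧ ≡ ⟦ m ⟧ + ⟦ k ⟧
⟦⟧-+ m k = begin
  + (m ℕ.+ k) / 1                                    ≡⟨ cong (_/ 1) numerator-sum ⟩
  (+ m ℤ.* + 1 ℤ.+ + k ℤ.* + 1) / 1                  ≡⟨⟩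
  mkℚ (+ m) 0 (coprime m) + mkℚ (+ k) 0 (coprime k)  ≡⟨ cong₂ _+_ (⟦⟧-canonical m) (⟦⟧-canonical k) ⟨
  ⟦ m ⟧ + ⟦ k ⟧                                      ∎
  where
  open ≡-Reasoning
  numerator-sum : + (m ℕ.+ k) ≡ + m ℤ.* + 1 ℤ.+ + k ℤ.* + 1
  numerator-sum = trans (ℤP.pos-+ m k) (sym (cong₂ ℤ._+_ (ℤP.*-identityʳ (+ m)) (ℤP.*-identityʳ (+ k))))

⟦⟧-mono : ∀ {m k} → m ℕ.≤ k → ⟦ m ⟧ ≤ ⟦ k ⟧
⟦⟧-mono {m} {k} m≤k rewrite ⟦⟧-canonical m | ⟦⟧-canonical k =
  *≤* (subst₂ ℤ._≤_ (sym (ℤP.*-identityʳ (+ m))) (sym (ℤP.*-identityʳ (+ k))) (ℤ.+≤+ m≤k))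

⟦⟧-cancel-≤ : ∀ {m k} → ⟦ m ⟧ ≤ ⟦ k ⟧ → m ℕ.≤ k
⟦⟧-cancel-≤ {m} {k} le rewrite ⟦⟧-canonical m | ⟦⟧-canonical k with le
... | *≤* le′ = ℤP.drop‿+≤+ (subst₂ ℤ._≤_ (ℤP.*-identityʳ (+ m)) (ℤP.*-identityʳ (+ k)) le′)

⟦⟧-injective : ∀ {m k} → ⟦ m ⟧ ≡ ⟦ k ⟧ → m ≡ k
⟦⟧-injective eq = ℕP.≤-antisym (⟦⟧-cancel-≤ (≤-reflexive eq)) (⟦⟧-cancel-≤ (≤-reflexive (sym eq)))

⟦⟧-⊓ : ∀ m k → ⟦ m ℕ.⊓ k ⟧ ≡ ⟦ m ⟧ ⊓ ⟦ k ⟧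
⟦⟧-⊓ m k with ℕP.≤-total m k
... | inj₁ m≤k rewrite ℕP.m≤n⇒m⊓n≡m m≤k = sym (p≤q⇒p⊓q≡p (⟦⟧-mono m≤k))
... | inj₂ k≤m rewrite ℕP.m≥n⇒m⊓n≡n k≤m = sym (p≥q⇒p⊓q≡q (⟦⟧-mono k≤m))

⟦⟧-nonneg : ∀ k → 0ℚ ≤ ⟦ k ⟧
⟦⟧-nonneg k = ⟦⟧-mono {0} {k} z≤n

half-double : ∀ h → ⟦ h ℕ.+ h ⟧ * ½ ≡ ⟦ h ⟧
half-double h = trans (cong (_* ½) (⟦⟧-+ h h)) (solve 1 (λ x → (x :+ x) :* con ½ := x) refl ⟦ h ⟧)

halfDiff : ℕ → ℕ → ℚ
halfDiff m s = ⟦ m ⟧ - ⟦ s ⟧ * ½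

halfDiff-+ : ∀ x s y t → halfDiff x s + halfDiff y t ≡ halfDiff (x ℕ.+ y) (s ℕ.+ t)
halfDiff-+ x s y t rewrite ⟦⟧-+ x y | ⟦⟧-+ s t =
  solve 4 (λ x s y t → (x :- s :* con ½) :+ (y :- t :* con ½) := (x :+ y) :- (s :+ t) :* con ½) refl ⟦ x ⟧ ⟦ s ⟧ ⟦ y ⟧ ⟦ t ⟧

halfDiff-shift : ∀ x s k → halfDiff (x ℕ.+ k) (s ℕ.+ (k ℕ.+ k)) ≡ halfDiff x s
halfDiff-shift x s k rewrite ⟦⟧-+ x k | ⟦⟧-+ s (k ℕ.+ k) | ⟦⟧-+ k k =
  solve 3 (λ x s k → (x :+ k) :- (s :+ (k :+ k)) :* con ½ := x :- s :* con ½) refl ⟦ x ⟧ ⟦ s ⟧ ⟦ k ⟧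

halfDiff-monoˡ : ∀ {x y} s → x ℕ.≤ y → halfDiff x s ≤ halfDiff y s
halfDiff-monoˡ s x≤y = +-monoˡ-≤ (- (⟦ s ⟧ * ½)) (⟦⟧-mono x≤y)

nonneg-half : ∀ q → 0ℚ ≤ q + q → 0ℚ ≤ q
nonneg-half q 0≤2q = subst (0ℚ ≤_) (solve 1 (λ q → (q :+ q) :* con ½ := q) refl q) (*-monoʳ-≤-nonNeg ½ 0≤2q)

⊓-redundant : ∀ x y a b → 0ℚ ≤ a → 0ℚ ≤ b → ((x ⊓ y) ⊓ (y + a)) ⊓ (y + b) ≡ x ⊓ y
⊓-redundant x y a b 0≤a 0≤b =
  trans (cong (_⊓ (y + b)) (p≤q⇒p⊓q≡p (below 0≤a))) (p≤q⇒p⊓q≡p (below 0≤b))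
  where
  below : ∀ {c} → 0ℚ ≤ c → x ⊓ y ≤ y + c
  below {c} 0≤c = ≤-trans (p⊓q≤q x y) (subst (_≤ y + c) (+-identityʳ y) (+-monoʳ-≤ y 0≤c))

NonnegSubmodSym : ∀ {n} → SetFn n → Set
NonnegSubmodSym f = Nonnegative f × Submodular f × Symmetric f

∁⊥≡⊤ : ∀ {n} → ∁ (⊥ {n}) ≡ ⊤
∁⊥≡⊤ = trans (sym (∪-identityˡ (∁ ⊥))) (p∪∁p≡⊤ ⊥)

-- A symmetric submodular function vanishing on ∅ is nonnegative:
-- 2f(S) = f(S) + f(S̄) ≥ f(V) + f(∅) = 2f(∅).
nonneg-from-submodular-symmetric : ∀ {n} (f : SetFn n) →
  Submodular f → Symmetric f → f ⊥ ≡ 0ℚ → Nonnegative f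
nonneg-from-submodular-symmetric f submod symm f⊥≡0 S = nonneg-half (f S) (begin
  0ℚ                        ≡⟨ cong₂ _+_ f⊥≡0 f⊥≡0 ⟨
  f ⊥ + f ⊥                 ≡⟨ cong (_+ f ⊥) (trans (symm ⊥) (cong f ∁⊥≡⊤)) ⟩
  f ⊤ + f ⊥                 ≡⟨ cong₂ (λ X Y → f X + f Y) (p∪∁p≡⊤ S) (∩-inverseʳ S) ⟨
  f (S ∪ ∁ S) + f (S ∩ ∁ S) ≤⟨ submod S (∁ S) ⟩
  f S + f (∁ S)             ≡⟨ cong (λ z → f S + z) (symm S) ⟨
  f S + f S                 ∎)
  where open ≤-Reasoning

pointwise-transfer : ∀ {n} {f g : SetFn n} → (∀ S → g S ≡ f S) → NonnegSubmodSym f → NonnegSubmodSym g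
pointwise-transfer g≡f (nonneg , submod , symm) =
  (λ S → subst (0ℚ ≤_) (sym (g≡f S)) (nonneg S)) ,
  (λ S T → subst₂ _≤_ (sym (cong₂ _+_ (g≡f (S ∪ T)) (g≡f (S ∩ T)))) (sym (cong₂ _+_ (g≡f S) (g≡f T))) (submod S T)) ,
  (λ S → trans (g≡f S) (trans (symm S) (sym (g≡f (∁ S)))))

module CutSetFunction (h β : ℕ) (R : Subset (h ℕ.+ h)) where

  open CutFunction h β
  open Crossings
  open SubsetCardinality

  inside outside size : Subset (h ℕ.+ h) → ℕ
  inside  S = ∣ S ∩ R ∣
  outside S = ∣ S ∩ ∁ R ∣
  size    S = inside S ℕ.+ outside S

  ⟦M⟧ : ∀ a b → ⟦ M a b ⟧ ≡ ((⟦ a ℕ.+ b ⟧ ⊓ (⟦ h ℕ.+ h ⟧ * ½)) ⊓ (⟦ β ⟧ + ⟦ a ⟧)) ⊓ (⟦ β ⟧ + ⟦ b ⟧)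
  ⟦M⟧ a b = begin
    ⟦ M a b ⟧
      ≡⟨ ⟦⟧-⊓ (((a ℕ.+ b) ℕ.⊓ h) ℕ.⊓ (β ℕ.+ a)) (β ℕ.+ b) ⟩
    ⟦ ((a ℕ.+ b) ℕ.⊓ h) ℕ.⊓ (β ℕ.+ a) ⟧ ⊓ ⟦ β ℕ.+ b ⟧
      ≡⟨ cong (_⊓ ⟦ β ℕ.+ b ⟧) (⟦⟧-⊓ ((a ℕ.+ b) ℕ.⊓ h) (β ℕ.+ a)) ⟩
    (⟦ (a ℕ.+ b) ℕ.⊓ h ⟧ ⊓ ⟦ β ℕ.+ a ⟧) ⊓ ⟦ β ℕ.+ b ⟧
      ≡⟨ cong (λ z → (z ⊓ ⟦ β ℕ.+ a ⟧) ⊓ ⟦ β ℕ.+ b ⟧) (⟦⟧-⊓ (a ℕ.+ b) h) ⟩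
    ((⟦ a ℕ.+ b ⟧ ⊓ ⟦ h ⟧) ⊓ ⟦ β ℕ.+ a ⟧) ⊓ ⟦ β ℕ.+ b ⟧
      ≡⟨ cong₂ (λ x y → ((⟦ a ℕ.+ b ⟧ ⊓ x) ⊓ ⟦ β ℕ.+ a ⟧) ⊓ y) (half-double h) (sym (⟦⟧-+ β b)) ⟨
    ((⟦ a ℕ.+ b ⟧ ⊓ (⟦ h ℕ.+ h ⟧ * ½)) ⊓ ⟦ β ℕ.+ a ⟧) ⊓ (⟦ β ⟧ + ⟦ b ⟧)
      ≡⟨ cong (λ x → ((⟦ a ℕ.+ b ⟧ ⊓ (⟦ h ℕ.+ h ⟧ * ½)) ⊓ x) ⊓ (⟦ β ⟧ + ⟦ b ⟧)) (⟦⟧-+ β a) ⟩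
    ((⟦ a ℕ.+ b ⟧ ⊓ (⟦ h ℕ.+ h ⟧ * ½)) ⊓ (⟦ β ⟧ + ⟦ a ⟧)) ⊓ (⟦ β ⟧ + ⟦ b ⟧) ∎
    where open ≡-Reasoning

  f₂-representation : ∀ S → f₂ (h ℕ.+ h) β R S ≡ halfDiff (M (inside S) (outside S)) (size S)
  f₂-representation S rewrite sym (card-split S R) = cong (_- ⟦ size S ⟧ * ½) (sym (⟦M⟧ (inside S) (outside S)))

  f₂-submodular : h ℕ.≤ β ℕ.+ β → Submodular (f₂ (h ℕ.+ h) β R)
  f₂-submodular h≤2β S T = begin
    f₂ (h ℕ.+ h) β R (S ∪ T) + f₂ (h ℕ.+ h) β R (S ∩ T)
      ≡⟨ cong₂ _+_ (f₂-representation (S ∪ T)) (f₂-representation (S ∩ T)) ⟩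
    halfDiff (M′ (S ∪ T)) (size (S ∪ T)) + halfDiff (M′ (S ∩ T)) (size (S ∩ T))
      ≡⟨ halfDiff-+ (M′ (S ∪ T)) (size (S ∪ T)) (M′ (S ∩ T)) (size (S ∩ T)) ⟩
    halfDiff (M′ (S ∪ T) ℕ.+ M′ (S ∩ T)) (size (S ∪ T) ℕ.+ size (S ∩ T))
      ≤⟨ halfDiff-monoˡ (size (S ∪ T) ℕ.+ size (S ∩ T)) (M-submodular h≤2β cross-in cross-out) ⟩
    halfDiff (M′ S ℕ.+ M′ T) (size (S ∪ T) ℕ.+ size (S ∩ T))
      ≡⟨ cong (halfDiff (M′ S ℕ.+ M′ T)) (Crossing.modular (crossing-+ cross-in cross-out)) ⟩
    halfDiff (M′ S ℕ.+ M′ T) (size S ℕ.+ size T)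
      ≡⟨ halfDiff-+ (M′ S) (size S) (M′ T) (size T) ⟨
    halfDiff (M′ S) (size S) + halfDiff (M′ T) (size T)
      ≡⟨ cong₂ _+_ (f₂-representation S) (f₂-representation T) ⟨
    f₂ (h ℕ.+ h) β R S + f₂ (h ℕ.+ h) β R T ∎
    where
    open ≤-Reasoning
    M′ : Subset (h ℕ.+ h) → ℕ
    M′ X = M (inside X) (outside X)
    cross-in = restriction-crossing S T R
    cross-out = restriction-crossing S T (∁ R)

  f₂-symmetric : ∣ R ∣ ≡ h → Symmetric (f₂ (h ℕ.+ h) β R)
  f₂-symmetric |R|≡h S = begin
    f₂ (h ℕ.+ h) β R S
      ≡⟨ f₂-representation S ⟩
    halfDiff (M′ S) (size S)
      ≡⟨ halfDiff-shift (M′ S) (size S) h ⟨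
    halfDiff (M′ S ℕ.+ h) (size S ℕ.+ (h ℕ.+ h))
      ≡⟨ cong₂ halfDiff (M-complement {inside S} {inside (∁ S)} {outside S} {outside (∁ S)} in-split out-split) sizes ⟨
    halfDiff (M′ (∁ S) ℕ.+ size S) (size (∁ S) ℕ.+ (size S ℕ.+ size S))
      ≡⟨ halfDiff-shift (M′ (∁ S)) (size (∁ S)) (size S) ⟩
    halfDiff (M′ (∁ S)) (size (∁ S))
      ≡⟨ f₂-representation (∁ S) ⟨
    f₂ (h ℕ.+ h) β R (∁ S) ∎
    where
    open ≡-Reasoning
    M′ : Subset (h ℕ.+ h) → ℕ
    M′ X = M (inside X) (outside X)
    in-split : inside S ℕ.+ inside (∁ S) ≡ h
    in-split = trans (complement-split S R) |R|≡h
    out-split : outside S ℕ.+ outside (∁ S) ≡ h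
    out-split = trans (complement-split S (∁ R)) (card-∁-half R |R|≡h)
    sizes : size (∁ S) ℕ.+ (size S ℕ.+ size S) ≡ size S ℕ.+ (h ℕ.+ h)
    sizes = begin
      size (∁ S) ℕ.+ (size S ℕ.+ size S)  ≡⟨ ℕP.+-comm (size (∁ S)) (size S ℕ.+ size S) ⟩
      (size S ℕ.+ size S) ℕ.+ size (∁ S)  ≡⟨ ℕP.+-assoc (size S) (size S) (size (∁ S)) ⟩
      size S ℕ.+ (size S ℕ.+ size (∁ S))  ≡⟨ cong (size S ℕ.+_) total ⟩
      size S ℕ.+ (h ℕ.+ h)                ∎
      where
      total : size S ℕ.+ size (∁ S) ≡ h ℕ.+ h
      total = trans (ℕ-interchange (inside S) (outside S) (inside (∁ S)) (outside (∁ S)))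
                    (cong₂ ℕ._+_ in-split out-split)

  f₂-empty : f₂ (h ℕ.+ h) β R ⊥ ≡ 0ℚ
  f₂-empty = trans (f₂-representation ⊥)
    (cong₂ (λ a b → halfDiff (M a b) (a ℕ.+ b)) (card-⊥∩ R) (card-⊥∩ (∁ R)))

  f₂-properties : h ℕ.≤ β ℕ.+ β → ∣ R ∣ ≡ h → NonnegSubmodSym (f₂ (h ℕ.+ h) β R)
  f₂-properties h≤2β |R|≡h =
    nonneg-from-submodular-symmetric (f₂ (h ℕ.+ h) β R) submod symm f₂-empty , submod , symm
    where
    submod = f₂-submodular h≤2β
    symm = f₂-symmetric |R|≡h

f₁-as-f₂ : ∀ h (R : Subset (h ℕ.+ h)) S → f₁ (h ℕ.+ h) S ≡ f₂ (h ℕ.+ h) h R S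
f₁-as-f₂ h R S = cong (_- card S * ½) (sym (begin
  ((card S ⊓ H) ⊓ (⟦ h ⟧ + card (S ∩ R))) ⊓ (⟦ h ⟧ + card (S ∩ ∁ R))
    ≡⟨ cong (λ y → ((card S ⊓ H) ⊓ (y + card (S ∩ R))) ⊓ (y + card (S ∩ ∁ R))) (half-double h) ⟨
  ((card S ⊓ H) ⊓ (H + card (S ∩ R))) ⊓ (H + card (S ∩ ∁ R))
    ≡⟨ ⊓-redundant (card S) H (card (S ∩ R)) (card (S ∩ ∁ R)) (⟦⟧-nonneg ∣ S ∩ R ∣) (⟦⟧-nonneg ∣ S ∩ ∁ R ∣) ⟩
  card S ⊓ H ∎))
  where
  open ≡-Reasoning
  H = ⟦ h ℕ.+ h ⟧ * ½

both-properties : ∀ h β → h ℕ.≤ β ℕ.+ β → (R : Subset (h ℕ.+ h)) → ∣ R ∣ ≡ h →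
  NonnegSubmodSym (f₁ (h ℕ.+ h)) × NonnegSubmodSym (f₂ (h ℕ.+ h) β R)
both-properties h β h≤2β R |R|≡h =
  pointwise-transfer (f₁-as-f₂ h R) (CutSetFunction.f₂-properties h h R (ℕP.m≤m+n h h) |R|≡h) ,
  CutSetFunction.f₂-properties h β R h≤2β |R|≡h

β-bound : ∀ h β {ε} → 0ℚ < ε → ⟦ β ⟧ ≡ (⟦ h ℕ.+ h ⟧ * (+ 1 / 4)) * (1ℚ + ε) → h ℕ.≤ β ℕ.+ β
β-bound h β {ε} 0<ε β-eq = ⟦⟧-cancel-≤ (begin
  ⟦ h ⟧                  ≡⟨ trans (solve 1 (λ x → x :* con q :+ x :* con q := x :* con ½) refl ⟦ h ℕ.+ h ⟧) (half-double h) ⟨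
  quarter + quarter      ≤⟨ +-mono-≤ quarter≤β quarter≤β ⟩
  ⟦ β ⟧ + ⟦ β ⟧          ≡⟨ ⟦⟧-+ β β ⟨
  ⟦ β ℕ.+ β ⟧            ∎)
  where
  open ≤-Reasoning
  q = + 1 / 4
  quarter = ⟦ h ℕ.+ h ⟧ * q
  quarter≤β : quarter ≤ ⟦ β ⟧
  quarter≤β = begin
    quarter               ≡⟨ *-identityʳ quarter ⟨
    quarter * 1ℚ          ≤⟨ *-monoˡ-≤-nonNeg quarter {{nonNegative (*-monoʳ-≤-nonNeg q (⟦⟧-nonneg (h ℕ.+ h)))}}
                               (+-monoʳ-≤ 1ℚ (<⇒≤ 0<ε)) ⟩
    quarter * (1ℚ + ε)    ≡⟨ β-eq ⟨
    ⟦ β ⟧                 ∎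

double : ∀ h → h ℕ.* 2 ≡ h ℕ.+ h
double h = trans (ℕP.*-comm h 2) (cong (h ℕ.+_) (ℕP.+-identityʳ h))

lemma3 : (n : ℕ) → 2 ∣ n →
         (ε : ℚ) → 0ℚ < ε →
         (β : ℕ) → ⟦ β ⟧ ≡ (⟦ n ⟧ * (+ 1 / 4)) * (1ℚ + ε) →
         (R : Subset n) → card R ≡ ⟦ n ⟧ * (+ 1 / 2) →
         (Nonnegative (f₁ n) × Submodular (f₁ n) × Symmetric (f₁ n))
         × (Nonnegative (f₂ n β R) × Submodular (f₂ n β R) × Symmetric (f₂ n β R))
lemma3 n (divides h n≡h*2) = even-case (trans n≡h*2 (double h))
  where
  even-case : n ≡ h ℕ.+ h → (ε : ℚ) → 0ℚ < ε →
    (β : ℕ) → ⟦ β ⟧ ≡ (⟦ n ⟧ * (+ 1 / 4)) * (1ℚ + ε) →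
    (R : Subset n) → card R ≡ ⟦ n ⟧ * ½ →
    NonnegSubmodSym (f₁ n) × NonnegSubmodSym (f₂ n β R)
  even-case refl ε 0<ε β β-eq R card-R =
    both-properties h β (β-bound h β 0<ε β-eq) R (⟦⟧-injective (trans card-R (half-double h)))
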